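{- Let $n,d$ be positive integers. If $n\le 3$ or $d\le 2$, then $H_{\mathrm{c.l.m.}}(n,d)=(n-1)d$.
   Context: A pure multicomplex of rank $d$ on an $n$-element set $V$ is a nonempty collection $M$ of multisets of size $d$ of elements of $V$ (its facets); multiset containment is taken with multiplicities. A connected layer multicomplex (c.l.m.) is such an $M$ together with a partition $M=L_a\sqcup L_{a+1}\sqcup\dots\sqcup L_b$ ($a\le b$ integers) of its facets into nonempty layers such that for every multiset $S$, the set of indices $i$ for which $L_i$ contains a facet containing $S$ is an interval of integers. Its length is $b-a$. $H_{\mathrm{c.l.m.}}(n,d)$ is the maximum length of c.l.m.'s of rank $d$ on an $n$-element set. -}

module Defs where

open import Data.Nat using (ℕ; suc; _≤_; _∸_; _*_)
open import Data.Fin using (Fin)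
import Data.Fin as Fin
open import Data.Vec using (Vec; lookup; sum)
open import Data.List using (List)
open import Data.List.Membership.Propositional using (_∈_)
open import Data.Product using (∃; _×_; Σ)
open import Relation.Binary.PropositionalEquality using (_≡_)

-- A multiset on the n-element set V = Fin n: multiplicity vector.
Multiset : ℕ → Set
Multiset n = Vec ℕ n

size : ∀ {n} → Multiset n → ℕ
size S = sum S

_⊆ₘ_ : ∀ {n} → Multiset n → Multiset n → Set
S ⊆ₘ F = ∀ i → lookup S i ≤ lookup F i

-- A connected layer multicomplex of rank d on Fin n with layers
-- L_0, ..., L_ℓ (the indices a..b are shifted to 0..b-a = ℓ, so ℓ is the length).
-- The multicomplex M is the union of the layers; each layer is a (nonempty)
-- finite collection of facets given as a list (repetitions are irrelevant).
record CLM (n d ℓ : ℕ) : Set where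
  field
    layer    : Fin (suc ℓ) → List (Multiset n)
    nonempty : ∀ i → ∃ λ F → F ∈ layer i
    rank     : ∀ i F → F ∈ layer i → size F ≡ d
    disjoint : ∀ i j F → F ∈ layer i → F ∈ layer j → i ≡ j

  Meets : Multiset n → Fin (suc ℓ) → Set
  Meets S i = ∃ λ F → F ∈ layer i × S ⊆ₘ F

  field
    interval : ∀ (S : Multiset n) (i j k : Fin (suc ℓ)) →
               i Fin.≤ j → j Fin.≤ k → Meets S i → Meets S k → Meets S j

IsHclm : ℕ → ℕ → ℕ → Set
IsHclm n d m = CLM n d m × (∀ ℓ → CLM n d ℓ → ℓ ≤ m)

module Submission where

-- Lower bound (any n ≥ 1, d): on Fin (m + 1) let layer k consist of all multisets of
-- size d and weight k, where weight F = Σᵢ i · F(i). The weights range over 0, …, m d,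
-- and the interval condition holds because a submultiset S of facets of weights i ≤ k
-- can be completed, within size d, to any weight j between them (extend-to-weight).
--
-- Upper bound, by cases. Then:
--   * n ≤ 2: a facet is determined by its size and weight, so the layers inject into
--     the weights 0, …, (n - 1) d (small-length);
--   * d = 0 or 1: facets are empty, resp. singletons, so layers inject into vertices;
--   * n = 3: a vertex shared by the first two and the last two layers lies in all the
--     inner layers, and its link there has rank d - 1 and length ℓ - 2 (shrink3);
--   * d = 2: by strong induction, (ℓ + 1) + #V(last layer) ≤ 2 #V (rank2-bound), cutting
--     at the first layer meeting the last one and applying the rank-1 bound to a link.

open import Defs
import Algebra.Properties.CommutativeSemigroup
open import Data.Fin as Fin using (Fin; zero; suc; toℕ)
import Data.Fin.Properties as FinP
open import Data.List using (List; []; _∷_; map; filter; upTo; cartesianProductWith)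
open import Data.List.Membership.Propositional using (_∈_; find; lose)
open import Data.List.Membership.Propositional.Properties
  using (∈-map∘filter⁺; ∈-map∘filter⁻; ∈-filter⁺; ∈-filter⁻; ∈-cartesianProductWith⁺; ∈-upTo⁺)
open import Data.List.Relation.Unary.Any using (here; any?)
open import Data.Nat using (ℕ; zero; suc; pred; _+_; _*_; _∸_; _≤_; _<_; z≤n; s≤s; s≤s⁻¹; _≤?_; _≟_; >-nonZero)
open import Data.Nat.Induction using (<-rec)
open import Data.Nat.Properties
open import Data.Nat.Solver using (module +-*-Solver)
open import Data.Product using (∃; ∃₂; _×_; _,_; proj₁; proj₂)
open import Data.Sum as Sum using (_⊎_; inj₁; inj₂; [_,_]′)
open import Data.Vec using ([]; _∷_; lookup; sum; replicate; updateAt; zipWith)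
open import Data.Vec.Properties
  using ( lookup-zipWith; lookup∘updateAt; lookup∘updateAt′; updateAt-id-local; updateAt-updateAt-local
        ; lookup-replicate)
open import Function using (id; _∘_)
open import Relation.Binary.PropositionalEquality
  using (_≡_; _≢_; refl; sym; trans; cong; cong₂; subst; subst₂; module ≡-Reasoning)
open import Relation.Nullary using (¬_; ¬?; Dec; yes; no; contradiction)
open import Relation.Nullary.Decidable using (map′; _×-dec_)
open import Relation.Unary using (Decidable)

open +-*-Solver using (solve; _:*_; _:+_; con; _:=_)
open Algebra.Properties.CommutativeSemigroup +-commutativeSemigroup using (interchange)

private
  variable
    n d ℓ : ℕ

⊆-refl : (S : Multiset n) → S ⊆ₘ S
⊆-refl S i = ≤-refl

⊆-trans : {S T F : Multiset n} → S ⊆ₘ T → T ⊆ₘ F → S ⊆ₘ F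
⊆-trans S⊆T T⊆F i = ≤-trans (S⊆T i) (T⊆F i)

_⊆?_ : (S F : Multiset n) → Dec (S ⊆ₘ F)
S ⊆? F = FinP.all? (λ i → lookup S i ≤? lookup F i)

lookup≤size : (F : Multiset n) (i : Fin n) → lookup F i ≤ size F
lookup≤size (x ∷ xs) zero    = m≤m+n x (sum xs)
lookup≤size (x ∷ xs) (suc i) = ≤-trans (lookup≤size xs i) (m≤n+m (sum xs) x)

⊆-size : {S F : Multiset n} → S ⊆ₘ F → size S ≤ size F
⊆-size {S = []}     {[]}     _   = z≤n
⊆-size {S = x ∷ xs} {y ∷ ys} S⊆F = +-mono-≤ (S⊆F zero) (⊆-size {S = xs} {ys} (λ i → S⊆F (suc i)))

⊆-size-≡ : {S F : Multiset n} → S ⊆ₘ F → size F ≤ size S → S ≡ F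
⊆-size-≡ {S = []}     {[]}     _   _ = refl
⊆-size-≡ {S = x ∷ xs} {y ∷ ys} S⊆F big = cong₂ _∷_ x≡y (⊆-size-≡ {S = xs} {ys} tail⊆ (+-cancelˡ-≤ y _ _ tail-big))
  where
  tail⊆ : xs ⊆ₘ ys
  tail⊆ i = S⊆F (suc i)
  x≡y : x ≡ y
  x≡y = ≤-antisym (S⊆F zero) (+-cancelʳ-≤ (sum ys) y x (≤-trans big (+-monoʳ-≤ x (⊆-size {S = xs} {ys} tail⊆))))
  tail-big : y + sum ys ≤ y + sum xs
  tail-big = subst (λ z → y + sum ys ≤ z + sum xs) x≡y big

some-element : (F : Multiset n) {k : ℕ} → size F ≡ suc k → ∃ λ v → 1 ≤ lookup F v
some-element (zero  ∷ xs) eq with some-element xs eq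
... | v , occurs = suc v , occurs
some-element (suc x ∷ xs) _ = zero , s≤s z≤n

not-⊆ : {F G : Multiset n} → ¬ F ⊆ₘ G → ∃ λ v → lookup G v < lookup F v
not-⊆ {F = F} {G} F⊈G with FinP.¬∀⟶∃¬ _ _ (λ i → lookup F i ≤? lookup G i) F⊈G
... | v , ¬≤ = v , ≰⇒> ¬≤

differing-elements : {F G : Multiset n} → size F ≡ size G → F ≢ G →
                     ∃₂ λ a b → a ≢ b × 1 ≤ lookup F a × 1 ≤ lookup G b
differing-elements {F = F} {G} same-size F≢G
  with not-⊆ {F = F} {G} (λ F⊆G → F≢G (⊆-size-≡ {S = F} F⊆G (≤-reflexive (sym same-size))))
     | not-⊆ {F = G} {F} (λ G⊆F → F≢G (sym (⊆-size-≡ {S = G} G⊆F (≤-reflexive same-size))))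
... | a , Ga<Fa | b , Fb<Gb = a , b , a≢b , ≤-trans (s≤s z≤n) Ga<Fa , ≤-trans (s≤s z≤n) Fb<Gb
  where
  a≢b : a ≢ b
  a≢b refl = <-asym Ga<Fa Fb<Gb

∅ₘ : Multiset n
∅ₘ = replicate _ 0

add : Fin n → Multiset n → Multiset n
add v S = updateAt S v suc

remove : Fin n → Multiset n → Multiset n
remove v F = updateAt F v pred

⁅_⁆ : Fin n → Multiset n
⁅ v ⁆ = add v ∅ₘ

size≡0 : (F : Multiset n) → size F ≡ 0 → F ≡ ∅ₘ
size≡0 []           _  = refl
size≡0 (zero ∷ xs) eq = cong (0 ∷_) (size≡0 xs eq)

size-remove : (v : Fin n) (F : Multiset n) → 1 ≤ lookup F v → suc (size (remove v F)) ≡ size F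
size-remove zero    (suc x ∷ xs) _ = refl
size-remove (suc v) (x ∷ xs) occurs =
  trans (sym (+-suc x (sum (remove v xs)))) (cong (x +_) (size-remove v xs occurs))

remove-add : (v : Fin n) (S : Multiset n) → remove v (add v S) ≡ S
remove-add v S = trans (updateAt-updateAt-local v {h = id} S refl) (updateAt-id-local v S refl)

add-remove : (v : Fin n) (F : Multiset n) → 1 ≤ lookup F v → add v (remove v F) ≡ F
add-remove v F occurs =
  trans (updateAt-updateAt-local v {h = id} F (suc-pred (lookup F v) {{>-nonZero occurs}}))
        (updateAt-id-local v F refl)

remove⊆ : (v : Fin n) (F : Multiset n) → remove v F ⊆ₘ F
remove⊆ v F w with w Fin.≟ v
... | yes refl = subst (_≤ lookup F v) (sym (lookup∘updateAt v F)) pred[n]≤n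
... | no w≢v = ≤-reflexive (lookup∘updateAt′ w v w≢v F)

updateAt-mono : {f : ℕ → ℕ} → (∀ {x y} → x ≤ y → f x ≤ f y) →
                (v : Fin n) {S T : Multiset n} → S ⊆ₘ T → updateAt S v f ⊆ₘ updateAt T v f
updateAt-mono f-mono v {S} {T} S⊆T w with w Fin.≟ v
... | yes refl = subst₂ _≤_ (sym (lookup∘updateAt v S)) (sym (lookup∘updateAt v T)) (f-mono (S⊆T v))
... | no w≢v   = subst₂ _≤_ (sym (lookup∘updateAt′ w v w≢v S)) (sym (lookup∘updateAt′ w v w≢v T)) (S⊆T w)

∅⊆ : {F : Multiset n} → ∅ₘ ⊆ₘ F
∅⊆ {F = F} i = subst (_≤ lookup F i) (sym (lookup-replicate i 0)) z≤n

add⊆⇒⊆remove : (v : Fin n) {S F : Multiset n} → add v S ⊆ₘ F → S ⊆ₘ remove v F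
add⊆⇒⊆remove v {S} {F} h =
  subst (_⊆ₘ remove v F) (remove-add v S) (updateAt-mono pred-mono-≤ v {add v S} {F} h)

⊆remove⇒add⊆ : (v : Fin n) {S F : Multiset n} → 1 ≤ lookup F v → S ⊆ₘ remove v F → add v S ⊆ₘ F
⊆remove⇒add⊆ v {S} {F} occurs h =
  subst (add v S ⊆ₘ_) (add-remove v F occurs) (updateAt-mono s≤s v {S} {remove v F} h)

add⊆⇒occurs : (v : Fin n) {S F : Multiset n} → add v S ⊆ₘ F → 1 ≤ lookup F v
add⊆⇒occurs v {S} {F} h = ≤-trans (s≤s z≤n) (subst (_≤ lookup F v) (lookup∘updateAt v S) (h v))

⁅⁆⊆ : (v : Fin n) (F : Multiset n) → 1 ≤ lookup F v → ⁅ v ⁆ ⊆ₘ F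
⁅⁆⊆ v F occurs = ⊆remove⇒add⊆ v {∅ₘ} {F} occurs (∅⊆ {F = remove v F})

size≡1 : (F : Multiset n) → size F ≡ 1 → ∃ λ v → F ≡ ⁅ v ⁆
size≡1 F eq with some-element F eq
... | v , occurs = v , (begin
  F                  ≡⟨ add-remove v F occurs ⟨
  add v (remove v F) ≡⟨ cong (add v) (size≡0 (remove v F) (suc-injective (trans (size-remove v F occurs) eq))) ⟩
  ⁅ v ⁆              ∎)
  where open ≡-Reasoning

infixl 6 _⊕_
_⊕_ : Multiset n → Multiset n → Multiset n
_⊕_ = zipWith _+_

-- The weight Σᵢ i · F(i) of a multiset; the layers of the extremal c.l.m. are its level sets.
weight : Multiset n → ℕ
weight []       = 0
weight (x ∷ xs) = weight xs + size xs

size-⊕ : (S T : Multiset n) → size (S ⊕ T) ≡ size S + size T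
size-⊕ []       []       = refl
size-⊕ (x ∷ xs) (y ∷ ys) = trans (cong (x + y +_) (size-⊕ xs ys)) (interchange x y (sum xs) (sum ys))

weight-⊕ : (S T : Multiset n) → weight (S ⊕ T) ≡ weight S + weight T
weight-⊕ []       []       = refl
weight-⊕ (x ∷ xs) (y ∷ ys) =
  trans (cong₂ _+_ (weight-⊕ xs ys) (size-⊕ xs ys)) (interchange (weight xs) (weight ys) (sum xs) (sum ys))

⊆-⊕ : (S T : Multiset n) → S ⊆ₘ (S ⊕ T)
⊆-⊕ S T i = subst (lookup S i ≤_) (sym (lookup-zipWith _+_ i S T)) (m≤m+n _ _)

difference : (S F : Multiset n) → S ⊆ₘ F → ∃ λ D → S ⊕ D ≡ F
difference []       []       _   = [] , refl
difference (x ∷ xs) (y ∷ ys) S⊆F with difference xs ys (λ i → S⊆F (suc i))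
... | D , xs⊕D≡ys = (y ∸ x) ∷ D , cong₂ _∷_ (m+[n∸m]≡n (S⊆F zero)) xs⊕D≡ys

-- Each copy of an element contributes at most n - 1 to the weight.
weight-≤ : (F : Multiset n) → weight F ≤ (n ∸ 1) * size F
weight-≤ []                 = z≤n
weight-≤ (x ∷ [])           = z≤n
weight-≤ {suc (suc k)} (x ∷ xs) = begin
  weight xs + sum xs         ≤⟨ +-monoˡ-≤ (sum xs) (weight-≤ xs) ⟩
  k * sum xs + sum xs        ≡⟨ +-comm (k * sum xs) (sum xs) ⟩
  suc k * sum xs             ≤⟨ *-monoʳ-≤ (suc k) (m≤n+m (sum xs) x) ⟩
  suc k * (x + sum xs)       ∎
  where open ≤-Reasoning

with-weight : ∀ m r t → t ≤ m * r → ∃ λ (R : Multiset (suc m)) → size R ≡ r × weight R ≡ t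
with-weight zero    r zero    _  = r ∷ [] , +-identityʳ r , refl
with-weight zero    r (suc t) ()
with-weight (suc m) r t t≤ with t ≤? r
... | yes t≤r with with-weight m t 0 z≤n
...   | R , size-t , weight-0 =
  (r ∸ t) ∷ R , trans (cong (r ∸ t +_) size-t) (m∸n+n≡m t≤r) , cong₂ _+_ weight-0 size-t
with-weight (suc m) r t t≤ | no t≰r
  with with-weight m r (t ∸ r) (subst (t ∸ r ≤_) (m+n∸m≡n r (m * r)) (∸-monoˡ-≤ r t≤))
...   | R , size-r , weight-t-r =
  0 ∷ R , size-r , trans (cong₂ _+_ weight-t-r size-r) (m∸n+n≡m (<⇒≤ (≰⇒> t≰r)))

extend-to-weight : {m w : ℕ} (S G : Multiset (suc m)) → S ⊆ₘ G → weight S ≤ w → w ≤ weight G →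
                   ∃ λ F → S ⊆ₘ F × size F ≡ size G × weight F ≡ w
extend-to-weight {m} {w} S G S⊆G S≤w w≤G with difference S G S⊆G
... | D , refl with with-weight m (size D) (w ∸ weight S) room
  where
  room : w ∸ weight S ≤ m * size D
  room = +-cancelˡ-≤ (weight S) _ _ (begin
    weight S + (w ∸ weight S) ≡⟨ m+[n∸m]≡n S≤w ⟩
    w                         ≤⟨ w≤G ⟩
    weight (S ⊕ D)            ≡⟨ weight-⊕ S D ⟩
    weight S + weight D       ≤⟨ +-monoʳ-≤ (weight S) (weight-≤ D) ⟩
    weight S + m * size D     ∎)
    where open ≤-Reasoning
... | R , size-R , weight-R = S ⊕ R , ⊆-⊕ S R
                              , trans (size-⊕ S R) (trans (cong (size S +_) size-R) (sym (size-⊕ S D)))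
                              , trans (weight-⊕ S R) (trans (cong (weight S +_) weight-R) (m+[n∸m]≡n S≤w))

size-weight-injective : n ≤ 2 → (F G : Multiset n) → size F ≡ size G → weight F ≡ weight G → F ≡ G
size-weight-injective _ []       []       _ _ = refl
size-weight-injective _ (x ∷ []) (y ∷ []) same-size _ = cong (_∷ []) (+-cancelʳ-≡ 0 x y same-size)
size-weight-injective _ (x ∷ y ∷ []) (x′ ∷ y′ ∷ []) same-size same-weight =
  cong₂ (λ u w → u ∷ w ∷ []) (+-cancelʳ-≡ (y + 0) x x′ (trans same-size (cong (x′ +_) (sym same-weight)))) y≡y′
  where
  y≡y′ : y ≡ y′
  y≡y′ = +-cancelʳ-≡ 0 y y′ same-weight
size-weight-injective (s≤s (s≤s ())) (_ ∷ _ ∷ _ ∷ _) _ _ _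

card : {P : Fin n → Set} → Decidable P → ℕ
card {zero}  P? = 0
card {suc n} P? with P? zero
... | yes _ = suc (card (λ v → P? (suc v)))
... | no  _ = card (λ v → P? (suc v))

card≤n : {P : Fin n → Set} (P? : Decidable P) → card P? ≤ n
card≤n {zero}  P? = z≤n
card≤n {suc n} P? with P? zero
... | yes _ = s≤s (card≤n (λ v → P? (suc v)))
... | no  _ = m≤n⇒m≤1+n (card≤n (λ v → P? (suc v)))

card-mono : {P Q : Fin n → Set} (P? : Decidable P) (Q? : Decidable Q) →
            (∀ v → P v → Q v) → card P? ≤ card Q?
card-mono {zero}  P? Q? P⇒Q = z≤n
card-mono {suc n} P? Q? P⇒Q with P? zero | Q? zero
... | yes _ | yes _  = s≤s (card-mono (λ v → P? (suc v)) (λ v → Q? (suc v)) (λ v → P⇒Q (suc v)))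
... | yes p | no ¬q  = contradiction (P⇒Q zero p) ¬q
... | no _  | yes _  = m≤n⇒m≤1+n (card-mono (λ v → P? (suc v)) (λ v → Q? (suc v)) (λ v → P⇒Q (suc v)))
... | no _  | no _   = card-mono (λ v → P? (suc v)) (λ v → Q? (suc v)) (λ v → P⇒Q (suc v))

card-∪ : {P Q R : Fin n → Set} (P? : Decidable P) (Q? : Decidable Q) (R? : Decidable R) →
         (∀ v → R v → P v ⊎ Q v) → card R? ≤ card P? + card Q?
card-∪ {zero}  P? Q? R? R⇒P∪Q = z≤n
card-∪ {suc n} P? Q? R? R⇒P∪Q
  with card-∪ (λ v → P? (suc v)) (λ v → Q? (suc v)) (λ v → R? (suc v)) (λ v → R⇒P∪Q (suc v))
     | P? zero | Q? zero | R? zero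
... | rest | yes _ | yes _ | yes _ = s≤s (≤-trans rest (+-monoʳ-≤ _ (n≤1+n _)))
... | rest | yes _ | no _  | yes _ = s≤s rest
... | rest | no _  | yes _ | yes _ = ≤-trans (s≤s rest) (≤-reflexive (sym (+-suc _ _)))
... | _    | no ¬p | no ¬q | yes r = contradiction (R⇒P∪Q zero r) [ ¬p , ¬q ]′
... | rest | yes _ | yes _ | no _  = m≤n⇒m≤1+n (≤-trans rest (+-monoʳ-≤ _ (n≤1+n _)))
... | rest | yes _ | no _  | no _  = m≤n⇒m≤1+n rest
... | rest | no _  | yes _ | no _  = ≤-trans rest (+-monoʳ-≤ _ (n≤1+n _))
... | rest | no _  | no _  | no _  = rest

card-disjoint : {P Q R : Fin n → Set} (P? : Decidable P) (Q? : Decidable Q) (R? : Decidable R) →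
                (∀ v → P v → R v) → (∀ v → Q v → R v) → (∀ v → P v → ¬ Q v) →
                card P? + card Q? ≤ card R?
card-disjoint {zero}  P? Q? R? P⇒R Q⇒R P∩Q=∅ = z≤n
card-disjoint {suc n} P? Q? R? P⇒R Q⇒R P∩Q=∅
  with card-disjoint (λ v → P? (suc v)) (λ v → Q? (suc v)) (λ v → R? (suc v))
                     (λ v → P⇒R (suc v)) (λ v → Q⇒R (suc v)) (λ v → P∩Q=∅ (suc v))
     | P? zero | Q? zero | R? zero
... | _    | yes p | yes q | _     = contradiction q (P∩Q=∅ zero p)
... | rest | yes _ | no _  | yes _ = s≤s rest
... | _    | yes p | no _  | no ¬r = contradiction (P⇒R zero p) ¬r
... | rest | no _  | yes _ | yes _ = ≤-trans (≤-reflexive (+-suc _ _)) (s≤s rest)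
... | _    | no _  | yes q | no ¬r = contradiction (Q⇒R zero q) ¬r
... | rest | no _  | no _  | yes _ = m≤n⇒m≤1+n rest
... | rest | no _  | no _  | no _  = rest

index : {P : Fin n → Set} (P? : Decidable P) (v : Fin n) → P v → Fin (card P?)
index {suc n} P? v p with P? zero
index P? zero    p | yes _  = zero
index P? (suc v) p | yes _  = suc (index (λ w → P? (suc w)) v p)
index P? zero    p | no ¬p0 = contradiction p ¬p0
index P? (suc v) p | no _   = index (λ w → P? (suc w)) v p

index-injective : {P : Fin n → Set} (P? : Decidable P) {v w : Fin n} (p : P v) (q : P w) →
                  index P? v p ≡ index P? w q → v ≡ w
index-injective {suc n} P? {v} {w} p q eq with P? zero
index-injective P? {zero}  {zero}  p q eq  | yes _ = refl
index-injective P? {suc v} {suc w} p q eq  | yes _ =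
  cong suc (index-injective (λ u → P? (suc u)) p q (FinP.suc-injective eq))
index-injective P? {zero}  {_}     p q eq  | no ¬p0 = contradiction p ¬p0
index-injective P? {suc v} {zero}  p q eq  | no ¬p0 = contradiction q ¬p0
index-injective P? {suc v} {suc w} p q eq  | no _ = cong suc (index-injective (λ u → P? (suc u)) p q eq)

card-injection : {k : ℕ} {P : Fin n → Set} (P? : Decidable P) (f : Fin k → Fin n) →
                 (∀ {i j} → f i ≡ f j → i ≡ j) → (∀ i → P (f i)) → k ≤ card P?
card-injection P? f f-injective inP =
  FinP.injective⇒≤ {f = λ i → index P? (f i) (inP i)}
                   (λ eq → f-injective (index-injective P? (inP _) (inP _) eq))

least-index : {P : Fin n → Set} → Decidable P → {k : Fin n} → P k →
              ∃ λ s → P s × (∀ j → toℕ j < toℕ s → ¬ P j)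
least-index {suc n} P? {k} pk with P? zero
... | yes p0 = zero , p0 , λ _ ()
least-index P? {zero}  pk | no ¬p0 = contradiction pk ¬p0
least-index P? {suc k} pk | no ¬p0 with least-index (λ j → P? (suc j)) pk
... | s , ps , below = suc s , ps , λ { zero _ → ¬p0 ; (suc j) j<s → below j (s≤s⁻¹ j<s) }

module _ (C : CLM n d ℓ) where
  open CLM C

  Occ : Fin (suc ℓ) → Fin n → Set
  Occ i v = Meets ⁅ v ⁆ i

  occ? : (i : Fin (suc ℓ)) → Decidable (Occ i)
  occ? i v = map′ find (λ (F , F∈ , v∈F) → lose F∈ v∈F) (any? (⁅ v ⁆ ⊆?_) (layer i))

  OccBefore : ℕ → Fin n → Set
  OccBefore t v = ∃ λ i → toℕ i ≤ t × Occ i v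

  OccAfter : ℕ → Fin n → Set
  OccAfter s v = ∃ λ k → s ≤ toℕ k × Occ k v

  occBefore? : (t : ℕ) → Decidable (OccBefore t)
  occBefore? t v = FinP.any? (λ i → (toℕ i ≤? t) ×-dec occ? i v)

  occAfter? : (s : ℕ) → Decidable (OccAfter s)
  occAfter? s v = FinP.any? (λ k → (s ≤? toℕ k) ×-dec occ? k v)

  Vertex : Fin n → Set
  Vertex v = ∃ λ i → Occ i v

  vertex? : Decidable Vertex
  vertex? v = FinP.any? (λ i → occ? i v)

  facet : Fin (suc ℓ) → Multiset n
  facet i = proj₁ (nonempty i)

  facet∈ : (i : Fin (suc ℓ)) → facet i ∈ layer i
  facet∈ i = proj₂ (nonempty i)

  facet-size : (i : Fin (suc ℓ)) → size (facet i) ≡ d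
  facet-size i = rank i (facet i) (facet∈ i)

  facet-injective : {i j : Fin (suc ℓ)} → facet i ≡ facet j → i ≡ j
  facet-injective {i} {j} eq = disjoint i j (facet i) (facet∈ i) (subst (_∈ layer j) (sym eq) (facet∈ j))

module _ (C : CLM n d ℓ) (s m : ℕ) (s+m≤ℓ : s + m ≤ ℓ) where
  open CLM C

  shift : Fin (suc m) → Fin (suc ℓ)
  shift j = Fin.fromℕ< {s + toℕ j} (s≤s (≤-trans (+-monoʳ-≤ s (FinP.toℕ≤pred[n] j)) s+m≤ℓ))

  toℕ-shift : (j : Fin (suc m)) → toℕ (shift j) ≡ s + toℕ j
  toℕ-shift j = FinP.toℕ-fromℕ< _

  shift-mono : {i j : Fin (suc m)} → toℕ i ≤ toℕ j → toℕ (shift i) ≤ toℕ (shift j)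
  shift-mono {i} {j} i≤j = subst₂ _≤_ (sym (toℕ-shift i)) (sym (toℕ-shift j)) (+-monoʳ-≤ s i≤j)

  restrict : CLM n d m
  restrict = record
    { layer    = λ j → layer (shift j)
    ; nonempty = λ j → nonempty (shift j)
    ; rank     = λ j → rank (shift j)
    ; disjoint = λ i j F F∈i F∈j → FinP.toℕ-injective (+-cancelˡ-≡ s _ _
        (trans (sym (toℕ-shift i)) (trans (cong toℕ (disjoint _ _ F F∈i F∈j)) (toℕ-shift j))))
    ; interval = λ S i j k i≤j j≤k → interval S (shift i) (shift j) (shift k) (shift-mono i≤j) (shift-mono j≤k)
    }

  occ-restrict : {v : Fin n} → OccBefore C s v → OccAfter C (s + m) v → (j : Fin (suc m)) → Occ restrict j v
  occ-restrict {v} (i , i≤s , v∈i) (k , s+m≤k , v∈k) j = interval ⁅ v ⁆ i (shift j) k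
    (≤-trans i≤s (subst (s ≤_) (sym (toℕ-shift j)) (m≤m+n s (toℕ j))))
    (≤-trans (subst (_≤ s + m) (sym (toℕ-shift j)) (+-monoʳ-≤ s (FinP.toℕ≤pred[n] j))) s+m≤k)
    v∈i v∈k

module _ (C : CLM n (suc d) ℓ) (v : Fin n) (everywhere : (i : Fin (suc ℓ)) → Occ C i v) where
  open CLM C

  linkLayer : Fin (suc ℓ) → List (Multiset n)
  linkLayer i = map (remove v) (filter (⁅ v ⁆ ⊆?_) (layer i))

  link-facet⁻ : {i : Fin (suc ℓ)} {G : Multiset n} → G ∈ linkLayer i →
                ∃ λ F → F ∈ layer i × G ≡ remove v F × 1 ≤ lookup F v
  link-facet⁻ G∈ with ∈-map∘filter⁻ (remove v) (⁅ v ⁆ ⊆?_) G∈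
  ... | F , F∈ , refl , v∈F = F , F∈ , refl , add⊆⇒occurs v {∅ₘ} {F} v∈F

  link-facet⁺ : {i : Fin (suc ℓ)} {F : Multiset n} → F ∈ layer i → 1 ≤ lookup F v → remove v F ∈ linkLayer i
  link-facet⁺ {F = F} F∈ occurs = ∈-map∘filter⁺ (remove v) (⁅ v ⁆ ⊆?_) (_ , F∈ , refl , ⁅⁆⊆ v F occurs)

  -- Containment of S in a link facet F - v is containment of S + v in F, so the
  -- interval condition for the link is that of C for S + v.
  link : CLM n d ℓ
  link = record
    { layer    = linkLayer
    ; nonempty = λ i → let (F , F∈ , v∈F) = everywhere i
                       in remove v F , link-facet⁺ F∈ (add⊆⇒occurs v {∅ₘ} {F} v∈F)
    ; rank     = λ i G G∈ → let (F , F∈ , G≡ , occurs) = link-facet⁻ G∈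
                            in suc-injective (trans (cong (suc ∘ size) G≡)
                                                    (trans (size-remove v F occurs) (rank i F F∈)))
    ; disjoint = λ i j G G∈i G∈j →
        let (F₁ , F₁∈ , G≡₁ , occurs₁) = link-facet⁻ G∈i
            (F₂ , F₂∈ , G≡₂ , occurs₂) = link-facet⁻ G∈j
            F₁≡F₂ = trans (sym (add-remove v F₁ occurs₁))
                      (trans (cong (add v) (trans (sym G≡₁) G≡₂)) (add-remove v F₂ occurs₂))
        in disjoint i j F₁ F₁∈ (subst (_∈ layer j) (sym F₁≡F₂) F₂∈)
    ; interval = λ S i j k i≤j j≤k (G₁ , G₁∈ , S⊆G₁) (G₂ , G₂∈ , S⊆G₂) →
        let (F₁ , F₁∈ , G≡₁ , occurs₁) = link-facet⁻ G₁∈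
            (F₂ , F₂∈ , G≡₂ , occurs₂) = link-facet⁻ G₂∈
            (H , H∈ , S+v⊆H) = interval (add v S) i j k i≤j j≤k
              (F₁ , F₁∈ , ⊆remove⇒add⊆ v {S} {F₁} occurs₁ (subst (S ⊆ₘ_) G≡₁ S⊆G₁))
              (F₂ , F₂∈ , ⊆remove⇒add⊆ v {S} {F₂} occurs₂ (subst (S ⊆ₘ_) G≡₂ S⊆G₂))
        in remove v H , link-facet⁺ H∈ (add⊆⇒occurs v {S} {H} S+v⊆H) , add⊆⇒⊆remove v {S} {H} S+v⊆H
    }

  link-occ : {i : Fin (suc ℓ)} {w : Fin n} → Occ link i w → Occ C i w
  link-occ {i} {w} (G , G∈ , w∈G) with link-facet⁻ G∈
  ... | F , F∈ , refl , _ = F , F∈ , ⊆-trans {S = ⁅ w ⁆} {remove v F} {F} w∈G (remove⊆ v F)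

bounded : ∀ n → ℕ → List (Multiset n)
bounded zero    b = [] ∷ []
bounded (suc n) b = cartesianProductWith _∷_ (upTo (suc b)) (bounded n b)

∈-bounded : {b : ℕ} (F : Multiset n) → (∀ i → lookup F i ≤ b) → F ∈ bounded n b
∈-bounded []       _     = here refl
∈-bounded (x ∷ xs) small =
  ∈-cartesianProductWith⁺ _∷_ (∈-upTo⁺ (s≤s (small zero))) (∈-bounded xs (λ i → small (suc i)))

module Extremal (m d : ℕ) where

  Level : Fin (suc (m * d)) → Multiset (suc m) → Set
  Level k F = size F ≡ d × weight F ≡ toℕ k

  level? : (k : Fin (suc (m * d))) → Decidable (Level k)
  level? k F = (size F ≟ d) ×-dec (weight F ≟ toℕ k)

  level : Fin (suc (m * d)) → List (Multiset (suc m))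
  level k = filter (level? k) (bounded (suc m) d)

  ∈-level⁺ : {k : Fin (suc (m * d))} {F : Multiset (suc m)} → Level k F → F ∈ level k
  ∈-level⁺ {F = F} F∈k@(size-d , _) =
    ∈-filter⁺ (level? _) (∈-bounded F (λ i → subst (lookup F i ≤_) size-d (lookup≤size F i))) F∈k

  ∈-level⁻ : {k : Fin (suc (m * d))} {F : Multiset (suc m)} → F ∈ level k → Level k F
  ∈-level⁻ F∈ = proj₂ (∈-filter⁻ (level? _) {xs = bounded (suc m) d} F∈)

  extremal : CLM (suc m) d (m * d)
  extremal = record
    { layer    = level
    ; nonempty = λ k → let (R , size-R , weight-R) = with-weight m d (toℕ k) (FinP.toℕ≤pred[n] k)
                       in R , ∈-level⁺ (size-R , weight-R)
    ; rank     = λ k F F∈ → proj₁ (∈-level⁻ F∈)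
    ; disjoint = λ i j F F∈i F∈j → FinP.toℕ-injective (trans (sym (proj₂ (∈-level⁻ F∈i))) (proj₂ (∈-level⁻ F∈j)))
    ; interval = λ S i j k i≤j j≤k (Fi , Fi∈ , S⊆Fi) (Fk , Fk∈ , S⊆Fk) →
        let (size-i , weight-i) = ∈-level⁻ Fi∈
            (size-k , weight-k) = ∈-level⁻ Fk∈
            (D , S⊕D≡Fi) = difference S Fi S⊆Fi
            S≤j = ≤-trans (subst (weight S ≤_) (trans (trans (sym (weight-⊕ S D)) (cong weight S⊕D≡Fi)) weight-i)
                                 (m≤m+n (weight S) (weight D))) i≤j
            (F , S⊆F , size-F , weight-F) =
              extend-to-weight S Fk S⊆Fk S≤j (≤-trans j≤k (≤-reflexive (sym weight-k)))
        in F , ∈-level⁺ (trans size-F size-k , weight-F) , S⊆F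
    }

-- A c.l.m. of rank 0 has a single layer, since all its facets are empty.
rank0-length : CLM n 0 ℓ → ℓ ≡ 0
rank0-length {ℓ = zero}  C = refl
rank0-length {ℓ = suc ℓ} C with facet-injective C {zero} {suc zero}
  (trans (size≡0 _ (facet-size C zero)) (sym (size≡0 _ (facet-size C (suc zero)))))
... | ()

-- In a c.l.m. of rank 1 distinct layers have distinct singleton facets,
-- so there are at least as many vertices as layers.
rank1-length : (C : CLM n 1 ℓ) → suc ℓ ≤ card (vertex? C)
rank1-length {n} {ℓ} C = card-injection (vertex? C) vertexOf vertexOf-injective (λ i → i , occurs i)
  where
  singleton : ∀ i → ∃ λ v → facet C i ≡ ⁅ v ⁆
  singleton i = size≡1 (facet C i) (facet-size C i)
  vertexOf : Fin (suc ℓ) → Fin n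
  vertexOf i = proj₁ (singleton i)
  vertexOf-injective : ∀ {i j} → vertexOf i ≡ vertexOf j → i ≡ j
  vertexOf-injective {i} {j} eq =
    facet-injective C (trans (proj₂ (singleton i)) (trans (cong ⁅_⁆ eq) (sym (proj₂ (singleton j)))))
  occurs : ∀ i → Occ C i (vertexOf i)
  occurs i = facet C i , facet∈ C i
           , subst (⁅ vertexOf i ⁆ ⊆ₘ_) (sym (proj₂ (singleton i))) (⊆-refl ⁅ vertexOf i ⁆)

-- Upper bound on at most two vertices: distinct layers have chosen facets of distinct
-- weights, and weights of facets of rank d range over 0, …, (n - 1) d.
small-length : n ≤ 2 → CLM n d ℓ → ℓ ≤ (n ∸ 1) * d
small-length {n} {d} {ℓ} n≤2 C = s≤s⁻¹ (FinP.injective⇒≤ {f = weightOf} weightOf-injective)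
  where
  weight-bound : ∀ i → weight (facet C i) < suc ((n ∸ 1) * d)
  weight-bound i = s≤s (subst (λ z → weight (facet C i) ≤ (n ∸ 1) * z) (facet-size C i) (weight-≤ (facet C i)))
  weightOf : Fin (suc ℓ) → Fin (suc ((n ∸ 1) * d))
  weightOf i = Fin.fromℕ< (weight-bound i)
  weightOf-injective : ∀ {i j} → weightOf i ≡ weightOf j → i ≡ j
  weightOf-injective {i} {j} eq = facet-injective C (size-weight-injective n≤2 _ _
    (trans (facet-size C i) (sym (facet-size C j)))
    (trans (sym (FinP.toℕ-fromℕ< (weight-bound i))) (trans (cong toℕ eq) (FinP.toℕ-fromℕ< (weight-bound j)))))

separating-vertices : (C : CLM n d ℓ) {i j : Fin (suc ℓ)} → i ≢ j →
                      ∃₂ λ a b → a ≢ b × Occ C i a × Occ C j b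
separating-vertices C {i} {j} i≢j
  with differing-elements {F = facet C i} {facet C j} (trans (facet-size C i) (sym (facet-size C j)))
                          (λ eq → i≢j (facet-injective C eq))
... | a , b , a≢b , a∈Fi , b∈Fj =
  a , b , a≢b , (facet C i , facet∈ C i , ⁅⁆⊆ a (facet C i) a∈Fi)
              , (facet C j , facet∈ C j , ⁅⁆⊆ b (facet C j) b∈Fj)

pairs-meet : (a b c e : Fin 3) → a ≢ b → c ≢ e → ∃ λ x → (x ≡ a ⊎ x ≡ b) × (x ≡ c ⊎ x ≡ e)
pairs-meet a b c e a≢b c≢e with FinP.pigeonhole (s≤s (s≤s (s≤s (s≤s z≤n)))) abce
  where
  abce : Fin 4 → Fin 3
  abce zero                   = a
  abce (suc zero)             = b
  abce (suc (suc zero))       = c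
  abce (suc (suc (suc zero))) = e
... | zero                 , suc zero                   , _ , eq = contradiction eq a≢b
... | zero                 , suc (suc zero)             , _ , eq = a , inj₁ refl , inj₁ eq
... | zero                 , suc (suc (suc zero))       , _ , eq = a , inj₁ refl , inj₂ eq
... | suc zero             , suc (suc zero)             , _ , eq = b , inj₂ refl , inj₁ eq
... | suc zero             , suc (suc (suc zero))       , _ , eq = b , inj₂ refl , inj₂ eq
... | suc (suc zero)       , suc (suc (suc zero))       , _ , eq = contradiction eq c≢e
... | suc zero             , suc zero                   , s≤s () , _
... | suc (suc _)          , suc zero                   , s≤s () , _
... | suc (suc _)          , suc (suc zero)             , s≤s (s≤s ()) , _
... | suc (suc (suc _))    , suc (suc (suc zero))       , s≤s (s≤s (s≤s ())) , _

common-vertex3 : (C : CLM 3 d ℓ) {i j i′ j′ : Fin (suc ℓ)} → i ≢ j → i′ ≢ j′ →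
                 ∃ λ x → (Occ C i x ⊎ Occ C j x) × (Occ C i′ x ⊎ Occ C j′ x)
common-vertex3 C {i} {j} {i′} {j′} i≢j i′≢j′
  with separating-vertices C i≢j | separating-vertices C i′≢j′
... | a , b , a≢b , a∈i , b∈j | c , e , c≢e , c∈i′ , e∈j′ with pairs-meet a b c e a≢b c≢e
... | x , x∈ab , x∈ce = x , Sum.map (λ { refl → a∈i }) (λ { refl → b∈j }) x∈ab
                          , Sum.map (λ { refl → c∈i′ }) (λ { refl → e∈j′ }) x∈ce

-- On three vertices, a c.l.m. of rank d + 1 and length L + 2 yields one of rank d and
-- length L: a vertex x lying in layer 0 or 1 and in layer L + 1 or L + 2 lies in all
-- layers 1, …, L + 1, and the link of x in these layers is the required c.l.m.
shrink3 : {L : ℕ} → CLM 3 (suc d) (2 + L) → CLM 3 d L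
shrink3 {d} {L} C = link inner x (occ-restrict C 1 L 1+L≤2+L {x} early late)
  where
  1+L≤2+L : 1 + L ≤ 2 + L
  1+L≤2+L = n≤1+n (suc L)
  inner : CLM 3 (suc d) L
  inner = restrict C 1 L 1+L≤2+L
  penultimate ultimate : Fin (3 + L)
  penultimate = Fin.inject₁ (Fin.fromℕ (suc L))
  ultimate    = Fin.fromℕ (2 + L)
  toℕ-penultimate : toℕ penultimate ≡ 1 + L
  toℕ-penultimate = trans (FinP.toℕ-inject₁ (Fin.fromℕ (suc L))) (FinP.toℕ-fromℕ (suc L))
  toℕ-ultimate : toℕ ultimate ≡ 2 + L
  toℕ-ultimate = FinP.toℕ-fromℕ (2 + L)
  shared : ∃ λ x → (Occ C zero x ⊎ Occ C (suc zero) x) × (Occ C penultimate x ⊎ Occ C ultimate x)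
  shared = common-vertex3 C (λ ()) (λ eq → FinP.fromℕ≢inject₁ (sym eq))
  x : Fin 3
  x = proj₁ shared
  early : OccBefore C 1 x
  early = [ (λ x∈0 → zero , z≤n , x∈0) , (λ x∈1 → suc zero , ≤-refl , x∈1) ]′ (proj₁ (proj₂ shared))
  late : OccAfter C (1 + L) x
  late = [ (λ x∈L+1 → penultimate , ≤-reflexive (sym toℕ-penultimate) , x∈L+1)
         , (λ x∈L+2 → ultimate , ≤-trans 1+L≤2+L (≤-reflexive (sym toℕ-ultimate)) , x∈L+2)
         ]′ (proj₂ (proj₂ shared))

length3 : ∀ d ℓ → CLM 3 d ℓ → ℓ ≤ 2 * d
length3 zero    ℓ             C = ≤-reflexive (rank0-length C)
length3 (suc d) zero          C = z≤n
length3 (suc d) (suc zero)    C = s≤s z≤n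
length3 (suc d) (suc (suc L)) C = subst (2 + L ≤_) (sym (*-suc 2 d)) (s≤s (s≤s (length3 d L (shrink3 C))))

-- The counting inequalities of rank2-from-later combine to the rank-2 bound.
rank2-arithmetic : ∀ {t m a p q r x u} → suc t + a ≤ 2 * p → suc m ≤ q → q ≤ a + r → x ≤ r → p + r ≤ u →
                   (suc t + suc m) + x ≤ 2 * u
rank2-arithmetic {t} {m} {a} {p} {q} {r} {x} {u} prefix tail split last disjoint =
  +-cancelˡ-≤ a _ _ (begin
    a + ((suc t + suc m) + x)
      ≡⟨ solve 4 (λ a t m x → a :+ ((t :+ m) :+ x) := ((t :+ a) :+ m) :+ x) refl a (suc t) (suc m) x ⟩
    ((suc t + a) + suc m) + x
      ≤⟨ +-mono-≤ (+-mono-≤ prefix (≤-trans tail split)) last ⟩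
    (2 * p + (a + r)) + r
      ≡⟨ solve 3 (λ a p r → (con 2 :* p :+ (a :+ r)) :+ r := a :+ con 2 :* (p :+ r)) refl a p r ⟩
    a + 2 * (p + r)
      ≤⟨ +-monoʳ-≤ a (*-monoʳ-≤ 2 disjoint) ⟩
    a + 2 * u
      ∎)
  where open ≤-Reasoning

Rank2Bound : CLM n 2 ℓ → Set
Rank2Bound {ℓ = ℓ} C = suc ℓ + card (occ? C (Fin.fromℕ ℓ)) ≤ 2 * card (vertex? C)

module _ (C : CLM n 2 ℓ) where

  private
    last : Fin (suc ℓ)
    last = Fin.fromℕ ℓ

    toℕ-last : toℕ last ≡ ℓ
    toℕ-last = FinP.toℕ-fromℕ ℓ

  MeetsLast : Fin (suc ℓ) → Set
  MeetsLast j = ∃ λ w → Occ C last w × Occ C j w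

  meetsLast? : Decidable MeetsLast
  meetsLast? j = FinP.any? (λ w → occ? C last w ×-dec occ? C j w)

  meetsLast-last : MeetsLast last
  meetsLast-last with some-element (facet C last) (facet-size C last)
  ... | w , w∈F = w , w∈last , w∈last
    where
    w∈last : Occ C last w
    w∈last = facet C last , facet∈ C last , ⁅⁆⊆ w (facet C last) w∈F

  -- If v lies in layer s and in the last layer, the link of v in the layers s, …, ℓ
  -- has rank 1, so the layers from s on have at least ℓ - s + 1 vertices.
  tail-bound : (s : Fin (suc ℓ)) {v : Fin n} → Occ C s v → Occ C last v →
               suc (ℓ ∸ toℕ s) ≤ card (occAfter? C (toℕ s))
  tail-bound s {v} v∈s v∈last =
    ≤-trans (rank1-length (link window v everywhere))
            (card-mono (vertex? (link window v everywhere)) (occAfter? C (toℕ s))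
                        (λ w (j , w∈j) → shift C _ _ fits j , shift-after j , link-occ window v everywhere w∈j))
    where
    fits : toℕ s + (ℓ ∸ toℕ s) ≤ ℓ
    fits = ≤-reflexive (m+[n∸m]≡n (FinP.toℕ≤pred[n] s))
    window : CLM n 2 (ℓ ∸ toℕ s)
    window = restrict C (toℕ s) (ℓ ∸ toℕ s) fits
    everywhere : ∀ j → Occ window j v
    everywhere = occ-restrict C _ _ fits (s , ≤-refl , v∈s)
                              (last , subst (toℕ s + (ℓ ∸ toℕ s) ≤_) (sym toℕ-last) fits , v∈last)
    shift-after : ∀ j → toℕ s ≤ toℕ (shift C _ _ fits j)
    shift-after j = subst (toℕ s ≤_) (sym (toℕ-shift C _ _ fits j)) (m≤m+n (toℕ s) (toℕ j))

  rank2-from-start : {v : Fin n} → Occ C zero v → Occ C last v → Rank2Bound C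
  rank2-from-start v∈0 v∈last =
    +-mono-≤ (≤-trans (tail-bound zero v∈0 v∈last)
                      (card-mono (occAfter? C 0) (vertex? C) (λ w (k , _ , w∈k) → k , w∈k)))
             (≤-trans (card-mono (occ? C last) (vertex? C) (λ w w∈last → last , w∈last))
                      (≤-reflexive (sym (+-identityʳ _))))

  -- The bound when layer t + 1 is the first layer meeting the last one, given the bound
  -- for the prefix of layers 0, …, t. With P the vertices of layers ≤ t, Q those of
  -- layers > t, A those of layer t and R = Q ∖ P: Q ⊆ A ∪ R (vertices form intervals),
  -- the last layer's vertices lie in R (minimality of t + 1), and P, R are disjoint.
  rank2-from-later : (s₀ : Fin ℓ) {v : Fin n} → Occ C (suc s₀) v → Occ C last v →
                     (∀ j → toℕ j ≤ toℕ s₀ → ¬ MeetsLast j) →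
                     Rank2Bound (restrict C 0 (toℕ s₀) (<⇒≤ (FinP.toℕ<n s₀))) → Rank2Bound C
  rank2-from-later s₀ v∈s v∈last minimal prefix-bound =
    subst (λ z → z + card (occ? C last) ≤ 2 * card (vertex? C)) ℓ+1
      (rank2-arithmetic
        (≤-trans prefix-bound (*-monoʳ-≤ 2 (card-mono (vertex? prefix) (occBefore? C t) prefix⊆P)))
        (tail-bound (suc s₀) v∈s v∈last)
        (card-∪ (occ? prefix (Fin.fromℕ t)) R? (occAfter? C (suc t)) Q⊆A∪R)
        (card-mono (occ? C last) R? last⊆R)
        (card-disjoint (occBefore? C t) R? (vertex? C) (λ w (i , _ , w∈i) → i , w∈i)
                       (λ w ((k , _ , w∈k) , _) → k , w∈k) (λ w w∈P (_ , w∉P) → w∉P w∈P)))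
    where
    t : ℕ
    t = toℕ s₀
    t≤ℓ : t ≤ ℓ
    t≤ℓ = <⇒≤ (FinP.toℕ<n s₀)
    prefix : CLM n 2 t
    prefix = restrict C 0 t t≤ℓ
    R : Fin n → Set
    R w = OccAfter C (suc t) w × ¬ OccBefore C t w
    R? : Decidable R
    R? w = occAfter? C (suc t) w ×-dec ¬? (occBefore? C t w)
    ℓ+1 : suc t + suc (ℓ ∸ suc t) ≡ suc ℓ
    ℓ+1 = trans (+-suc (suc t) _) (cong suc (m+[n∸m]≡n (FinP.toℕ<n s₀)))
    prefix⊆P : ∀ w → Vertex prefix w → OccBefore C t w
    prefix⊆P w (j , w∈j) =
      shift C 0 t t≤ℓ j , ≤-trans (≤-reflexive (toℕ-shift C 0 t t≤ℓ j)) (FinP.toℕ≤pred[n] j) , w∈j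
    toℕ-layer-t : toℕ (shift C 0 t t≤ℓ (Fin.fromℕ t)) ≡ t
    toℕ-layer-t = trans (toℕ-shift C 0 t t≤ℓ (Fin.fromℕ t)) (FinP.toℕ-fromℕ t)
    Q⊆A∪R : ∀ w → OccAfter C (suc t) w → Occ prefix (Fin.fromℕ t) w ⊎ R w
    Q⊆A∪R w w∈Q@(k , t<k , w∈k) with occBefore? C t w
    ... | yes (i , i≤t , w∈i) = inj₁ (CLM.interval C ⁅ w ⁆ i _ k (≤-trans i≤t (≤-reflexive (sym toℕ-layer-t)))
                                        (≤-trans (≤-reflexive toℕ-layer-t) (<⇒≤ t<k)) w∈i w∈k)
    ... | no w∉P = inj₂ (w∈Q , w∉P)
    last⊆R : ∀ w → Occ C last w → R w
    last⊆R w w∈last = (last , subst (suc t ≤_) (sym toℕ-last) (FinP.toℕ<n s₀) , w∈last)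
                    , λ (i , i≤t , w∈i) → minimal i i≤t (w , w∈last , w∈i)

rank2-bound : (C : CLM n 2 ℓ) → Rank2Bound C
rank2-bound {n} {ℓ} = <-rec (λ ℓ → (C : CLM n 2 ℓ) → Rank2Bound C) step ℓ
  where
  step : ∀ ℓ → (∀ {t} → t < ℓ → (C : CLM n 2 t) → Rank2Bound C) → (C : CLM n 2 ℓ) → Rank2Bound C
  step ℓ shorter C with least-index (meetsLast? C) (meetsLast-last C)
  ... | zero   , (v , v∈last , v∈0) , _     = rank2-from-start C v∈0 v∈last
  ... | suc s₀ , (v , v∈last , v∈s) , below =
    rank2-from-later C s₀ v∈s v∈last (λ j j≤t → below j (s≤s j≤t))
                     (shorter (FinP.toℕ<n s₀) (restrict C 0 (toℕ s₀) (<⇒≤ (FinP.toℕ<n s₀))))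

upper-bound : ∀ m d → (suc m ≤ 3 ⊎ d ≤ 2) → CLM (suc m) d ℓ → ℓ ≤ m * d
upper-bound zero                d (inj₁ _) C = small-length (s≤s z≤n) C
upper-bound (suc zero)          d (inj₁ _) C = small-length (s≤s (s≤s z≤n)) C
upper-bound (suc (suc zero))    d (inj₁ _) C = length3 d _ C
upper-bound (suc (suc (suc m))) d (inj₁ (s≤s (s≤s (s≤s ())))) C
upper-bound m 0 (inj₂ _) C = ≤-reflexive (trans (rank0-length C) (sym (*-zeroʳ m)))
upper-bound m 1 (inj₂ _) C =
  subst (_ ≤_) (sym (*-identityʳ m)) (s≤s⁻¹ (≤-trans (rank1-length C) (card≤n (vertex? C))))
upper-bound {ℓ} m 2 (inj₂ _) C = subst (ℓ ≤_) (*-comm 2 m) (s≤s⁻¹ (s≤s⁻¹ (begin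
  suc (suc ℓ)                                    ≡⟨ +-comm 1 (suc ℓ) ⟩
  suc ℓ + 1                                      ≤⟨ +-monoʳ-≤ (suc ℓ) last-nonempty ⟩
  suc ℓ + card (occ? C (Fin.fromℕ ℓ))            ≤⟨ rank2-bound C ⟩
  2 * card (vertex? C)                           ≤⟨ *-monoʳ-≤ 2 (card≤n (vertex? C)) ⟩
  2 * suc m                                      ≡⟨ *-suc 2 m ⟩
  suc (suc (2 * m))                              ∎)))
  where
  open ≤-Reasoning
  last-nonempty : 1 ≤ card (occ? C (Fin.fromℕ ℓ))
  last-nonempty with meetsLast-last C
  ... | w , w∈last , _ =
    card-injection (occ? C (Fin.fromℕ ℓ)) (λ _ → w) (λ { {zero} {zero} _ → refl }) (λ _ → w∈last)
upper-bound m (suc (suc (suc d))) (inj₂ (s≤s (s≤s ()))) C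

corollary3p15 : ∀ (n d : ℕ) → 1 ≤ n → 1 ≤ d → (n ≤ 3 ⊎ d ≤ 2) →
                IsHclm n d ((n ∸ 1) * d)
corollary3p15 (suc m) d _ _ small = Extremal.extremal m d , λ ℓ C → upper-bound m d small C
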